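{- For all integers $k\ge 3$ and $q\ge 1$, the graph $G(q,k)$ is $(k+1)$-vertex-critical.
   Context: For integers $q\ge 1$ and $k\ge 3$, $G(q,k)$ is the graph on vertex set $\{v_0,v_1,\dots,v_{kq}\}$ in which, with all indices taken modulo $kq+1$, the neighbourhood of $v_i$ is $\{v_{i-1},v_{i+1}\}\cup\{v_{i+kj+m} : m=2,3,\dots,k-1,\ j=0,1,\dots,q-1\}$. A graph $G$ is $t$-vertex-critical if $\chi(G)=t$ and $\chi(G-v)<t$ for every vertex $v$, where $\chi$ denotes the chromatic number. -}

module Defs where

open import Level using (0ℓ)
open import Data.Nat using (ℕ; suc; _+_; _*_; _∸_; _≤_; _<_; _%_)
open import Data.Fin using (Fin; toℕ)
open import Data.Product using (Σ; ∃; _×_; _,_; proj₁)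
open import Data.Sum using (_⊎_)
open import Relation.Binary.PropositionalEquality using (_≡_; _≢_)
open import Relation.Nullary using (¬_)

record Graph : Set₁ where
  field
    V   : Set
    Adj : V → V → Set
open Graph public

Colourable : Graph → ℕ → Set
Colourable G t = Σ (V G → Fin t) λ c → ∀ u w → Adj G u w → c u ≢ c w

ChromaticNumberIs : Graph → ℕ → Set
ChromaticNumberIs G t = Colourable G t × (∀ s → s < t → ¬ Colourable G s)

ChromaticNumberLt : Graph → ℕ → Set
ChromaticNumberLt G t = ∃ λ s → s < t × Colourable G s

deleteVertex : (G : Graph) → V G → Graph
deleteVertex G v = record
  { V   = Σ (V G) (λ u → u ≢ v)
  ; Adj = λ a b → Adj G (proj₁ a) (proj₁ b) }

VertexCritical : Graph → ℕ → Set
VertexCritical G t = ChromaticNumberIs G t × (∀ v → ChromaticNumberLt (deleteVertex G v) t)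

Offset : ℕ → ℕ → ℕ → Set
Offset q k d = d ≡ 1 ⊎ (∃ λ j → ∃ λ m → j < q × 2 ≤ m × m ≤ k ∸ 1 × d ≡ k * j + m)

-- Directed "i+d" relation modulo kq+1 (vertex v_i is Fin index i).
Step : (q k : ℕ) → Fin (suc (k * q)) → Fin (suc (k * q)) → Set
Step q k i j = ∃ λ d → Offset q k d × toℕ j ≡ (toℕ i + d) % suc (k * q)

-- G(q,k): v_i ~ v_j iff j = i + d or i = j + d (mod kq+1) for an offset d;
-- the symmetric closure also yields the neighbour v_{i-1}.
G : ℕ → ℕ → Graph
G q k = record
  { V   = Fin (suc (k * q))
  ; Adj = λ i j → Step q k i j ⊎ Step q k j i }

-- G(q,k) is a circulant graph, so the rotations of the indices are automorphisms, and
-- rotating any vertex v to v_{kq} reduces G - v to G - v_{kq}. That graph is properly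
-- coloured by i ↦ i mod k: every offset is nonzero mod k, and an edge that wraps around
-- past v_{kq} shifts the offset by kq + 1 ≡ 1 (mod k), which for offsets kj + m with
-- 2 ≤ m ≤ k - 1 still leaves a nonzero residue m - 1. Giving the deleted vertex an
-- extra colour shows χ(G) ≤ k + 1. Conversely, any k + 1 consecutive vertices
-- x, …, x + k contain a repeated colour, and all pairs among them except {x, x + k} are
-- adjacent, so a k-colouring would be k-periodic along the cycle; then v_{kq} and v_0
-- would share a colour although they are adjacent.
module Submission where

open import Defs
open import Data.Nat using (ℕ; zero; suc; _+_; _*_; _∸_; _≤_; _<_; _%_; NonZero; >-nonZero; z≤n; s≤s; s≤s⁻¹; z<s)
open import Data.Nat.Properties
open import Data.Nat.DivMod
open import Algebra.Properties.CommutativeSemigroup +-commutativeSemigroup using (xy∙z≈xz∙y)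
open import Data.Nat.Tactic.RingSolver using (solve-∀)
open import Data.Fin using (Fin; toℕ; fromℕ<; fromℕ; inject₁; inject≤) renaming (zero to fzero)
open import Data.Fin.Properties
  using (toℕ-injective; toℕ<n; toℕ-fromℕ<; fromℕ<-injective; fromℕ≢inject₁; inject₁-injective; inject≤-injective; pigeonhole)
  renaming (_≟_ to _≟ᶠ_)
open import Data.Product using (∃; _×_; _,_)
open import Data.Sum using (_⊎_; inj₁; inj₂; [_,_])
open import Data.Empty using (⊥-elim)
open import Function using (_∘_)
open import Relation.Nullary using (¬_; yes; no)
open import Relation.Binary.Definitions using (DecidableEquality)
open import Relation.Binary.PropositionalEquality hiding ([_])

[m%n+o]%n≡[m+o]%n : ∀ m o n .{{_ : NonZero n}} → (m % n + o) % n ≡ (m + o) % n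
[m%n+o]%n≡[m+o]%n m o n = begin
    (m % n + o) % n           ≡⟨ %-distribˡ-+ (m % n) o n ⟩
    (m % n % n + o % n) % n   ≡⟨ cong (λ z → (z + o % n) % n) (m%n%n≡m%n m n) ⟩
    (m % n + o % n) % n       ≡⟨ %-distribˡ-+ m o n ⟨
    (m + o) % n               ∎
  where open ≡-Reasoning

[m+n]%o-cases : ∀ m n {o} .{{_ : NonZero o}} → m < o → n < o →
                m + n ≡ (m + n) % o ⊎ m + n ≡ (m + n) % o + o
[m+n]%o-cases m n {o} m<o n<o with m + n <? o
... | yes no-wrap = inj₁ (sym (m<n⇒m%n≡m no-wrap))
... | no wrap = inj₂ (begin
    m + n               ≡⟨ m∸n+n≡m o≤ ⟨
    m + n ∸ o + o       ≡⟨ cong (_+ o) (m<n⇒m%n≡m (m<n+o⇒m∸n<o _ o (+-mono-< m<o n<o))) ⟨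
    (m + n ∸ o) % o + o ≡⟨ cong (_+ o) (m≤n⇒[n∸m]%m≡n%m o≤) ⟩
    (m + n) % o + o     ∎)
  where
  open ≡-Reasoning
  o≤ : o ≤ m + n
  o≤ = ≮⇒≥ wrap

[m+o]%n≢m%n : ∀ m {o n} .{{_ : NonZero n}} → 0 < o → o < n → (m + o) % n ≢ m % n
[m+o]%n≢m%n m {o} {n} 0<o o<n eq =
  [ (λ no-wrap → m<n⇒n≢0 0<o (+-cancelˡ-≡ (m % n) o 0 (trans no-wrap (trans back (sym (+-identityʳ (m % n)))))))
  , (λ wrap → <⇒≢ o<n (+-cancelˡ-≡ (m % n) o n (trans wrap (cong (_+ n) back))))
  ] ([m+n]%o-cases (m % n) o (m%n<n m n) o<n)
  where
  back : (m % n + o) % n ≡ m % n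
  back = trans ([m%n+o]%n≡[m+o]%n m o n) eq

[m+o]%n≡[m′+o]%n⇒m%n≡m′%n : ∀ m m′ {o n} .{{_ : NonZero n}} → o ≤ n →
                             (m + o) % n ≡ (m′ + o) % n → m % n ≡ m′ % n
[m+o]%n≡[m′+o]%n⇒m%n≡m′%n m m′ {o} {n} o≤n eq = begin
    m % n                         ≡⟨ undo m ⟨
    ((m + o) % n + (n ∸ o)) % n   ≡⟨ cong (λ z → (z + (n ∸ o)) % n) eq ⟩
    ((m′ + o) % n + (n ∸ o)) % n  ≡⟨ undo m′ ⟩
    m′ % n                        ∎
  where
  open ≡-Reasoning
  undo : ∀ x → ((x + o) % n + (n ∸ o)) % n ≡ x % n
  undo x = begin
    ((x + o) % n + (n ∸ o)) % n   ≡⟨ [m%n+o]%n≡[m+o]%n (x + o) (n ∸ o) n ⟩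
    (x + o + (n ∸ o)) % n         ≡⟨ cong (_% n) (+-assoc x o (n ∸ o)) ⟩
    (x + (o + (n ∸ o))) % n       ≡⟨ cong (λ z → (x + z) % n) (m+[n∸m]≡n o≤n) ⟩
    (x + n) % n                   ≡⟨ [m+n]%n≡m%n x n ⟩
    x % n                         ∎

m≤n∸1⇒m<n : ∀ {m n} .{{_ : NonZero n}} → m ≤ n ∸ 1 → m < n
m≤n∸1⇒m<n {n = suc _} = s≤s

m<n≤o⇒n∸m<o⊎endpoints : ∀ {m n o} → m < n → n ≤ o → n ∸ m < o ⊎ (m ≡ 0 × n ≡ o)
m<n≤o⇒n∸m<o⊎endpoints {zero} {n} {o} _ n≤o with n ≟ o
... | yes n≡o = inj₂ (refl , n≡o)
... | no n≢o = inj₁ (≤∧≢⇒< n≤o n≢o)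
m<n≤o⇒n∸m<o⊎endpoints {suc m} {n} m<n n≤o = inj₁ (<-≤-trans (∸-monoʳ-< {n} {suc m} {0} z<s (<⇒≤ m<n)) n≤o)

Colourable-mono : ∀ {G s t} → s ≤ t → Colourable G s → Colourable G t
Colourable-mono s≤t (c , proper) =
  (λ u → inject≤ (c u) s≤t) , λ u w adj → proper u w adj ∘ inject≤-injective s≤t s≤t (c u) (c w)

residue-colouring : ∀ {G k} .{{_ : NonZero k}} (f : V G → ℕ) →
                    (∀ u w → Adj G u w → f u % k ≢ f w % k) → Colourable G k
residue-colouring {k = k} f proper =
  (λ u → fromℕ< (m%n<n (f u) k)) , λ u w adj → proper u w adj ∘ fromℕ<-injective _ _ _ _

extend-colouring : ∀ {G t} (v : V G) → DecidableEquality (V G) → ¬ Adj G v v →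
                   Colourable (deleteVertex G v) t → Colourable G (suc t)
extend-colouring {G} {t} v _≟_ no-loop (c , proper) = colour , proper′
  where
  colour : V G → Fin (suc t)
  colour u with u ≟ v
  ... | yes _ = fromℕ t
  ... | no u≢v = inject₁ (c (u , u≢v))

  proper′ : ∀ u w → Adj G u w → colour u ≢ colour w
  proper′ u w adj with u ≟ v | w ≟ v
  ... | yes refl | yes refl = λ _ → no-loop adj
  ... | yes _    | no _     = fromℕ≢inject₁
  ... | no _     | yes _    = fromℕ≢inject₁ ∘ sym
  ... | no u≢v   | no w≢v   = proper (u , u≢v) (w , w≢v) adj ∘ inject₁-injective

module Circulant (q k : ℕ) (1<k : 1 < k) (1≤q : 1 ≤ q) where

  instance
    k-nonZero : NonZero k
    k-nonZero = >-nonZero (<-trans z<s 1<k)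

  n : ℕ
  n = suc (k * q)

  0<kq : 0 < k * q
  0<kq = *-mono-≤ (<⇒≤ 1<k) 1≤q

  Stepℕ : ℕ → ℕ → Set
  Stepℕ a b = ∃ λ d → Offset q k d × b ≡ (a + d) % n

  offset<n : ∀ {d} → Offset q k d → d < n
  offset<n (inj₁ refl) = s≤s 0<kq
  offset<n (inj₂ (j , m , j<q , _ , m≤k∸1 , refl)) = s≤s (begin
    k * j + m   ≤⟨ +-monoʳ-≤ (k * j) (≤-trans m≤k∸1 (m∸n≤m k 1)) ⟩
    k * j + k   ≡⟨ +-comm (k * j) k ⟩
    k + k * j   ≡⟨ *-suc k j ⟨
    k * suc j   ≤⟨ *-monoʳ-≤ k j<q ⟩
    k * q       ∎)
    where open ≤-Reasoning

  -- After a wrap past v_{kq} the step a → b is a + d = b + kq + 1, and kq + 1 ≡ 1 (mod k).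
  step-residue : ∀ {a b d} → a < k * q → Offset q k d → a + d ≡ b ⊎ a + d ≡ b + n →
                 ∃ λ r → 0 < r × r < k × (a + r) % k ≡ b % k
  step-residue _ (inj₁ refl) (inj₁ refl) = 1 , z<s , 1<k , refl
  step-residue {a} _ (inj₂ (j , m , _ , 2≤m , m≤k∸1 , refl)) (inj₁ refl) =
    m , <-trans z<s 2≤m , m≤n∸1⇒m<n m≤k∸1 ,
    trans (sym ([m+kn]%n≡m%n (a + m) j k)) (cong (_% k) (shuffle a m j k))
    where
    shuffle : ∀ a m j k → a + m + j * k ≡ a + (k * j + m)
    shuffle = solve-∀
  step-residue {a} {b} a<kq (inj₁ refl) (inj₂ a+1≡b+n) =
    ⊥-elim (<⇒≱ a<kq (subst (k * q ≤_) (sym a≡b+kq) (m≤n+m (k * q) b)))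
    where
    a≡b+kq : a ≡ b + k * q
    a≡b+kq = +-cancelʳ-≡ 1 a (b + k * q) (trans a+1≡b+n (trans (+-suc b (k * q)) (+-comm 1 (b + k * q))))
  step-residue {a} {b} _ (inj₂ (j , suc m , _ , s≤s 1≤m , m≤k∸1 , refl)) (inj₂ wrap) =
    m , 1≤m , <-trans (n<1+n m) (m≤n∸1⇒m<n m≤k∸1) , (begin
      (a + m) % k             ≡⟨ [m+kn]%n≡m%n (a + m) j k ⟨
      (a + m + j * k) % k     ≡⟨ cong (_% k) (suc-injective (trans (shuffleˡ a m j k) (trans wrap (shuffleʳ b q k)))) ⟩
      (b + q * k) % k         ≡⟨ [m+kn]%n≡m%n b q k ⟩
      b % k                   ∎)
    where
    open ≡-Reasoning
    shuffleˡ : ∀ a m j k → suc (a + m + j * k) ≡ a + (k * j + suc m)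
    shuffleˡ = solve-∀
    shuffleʳ : ∀ b q k → b + suc (k * q) ≡ suc (b + q * k)
    shuffleʳ = solve-∀

  residues-differ : ∀ {a b} → a < k * q → Stepℕ a b → a % k ≢ b % k
  residues-differ {a} a<kq (d , off , refl) a≡b
    with step-residue a<kq off ([m+n]%o-cases a d (<-trans a<kq (n<1+n (k * q))) (offset<n off))
  ... | r , 0<r , r<k , a+r≡b = [m+o]%n≢m%n a 0<r r<k (trans a+r≡b (sym a≡b))

  rotation : Fin n → ℕ → ℕ
  rotation v a = (a + (k * q ∸ toℕ v)) % n

  rotation-step : ∀ v {a b} → Stepℕ a b → Stepℕ (rotation v a) (rotation v b)
  rotation-step v {a} (d , off , refl) = d , off , (begin
      ((a + d) % n + s) % n   ≡⟨ [m%n+o]%n≡[m+o]%n (a + d) s n ⟩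
      (a + d + s) % n         ≡⟨ cong (_% n) (xy∙z≈xz∙y a d s) ⟩
      (a + s + d) % n         ≡⟨ [m%n+o]%n≡[m+o]%n (a + s) d n ⟨
      ((a + s) % n + d) % n   ∎)
    where
    open ≡-Reasoning
    s : ℕ
    s = k * q ∸ toℕ v

  rotation-self : ∀ v → rotation v (toℕ v) ≡ k * q
  rotation-self v = trans (cong (_% n) (m+[n∸m]≡n (s≤s⁻¹ (toℕ<n v)))) (m<n⇒m%n≡m (n<1+n (k * q)))

  rotation<kq : ∀ {v i} → i ≢ v → rotation v (toℕ i) < k * q
  rotation<kq {v} {i} i≢v =
    ≤∧≢⇒< (s≤s⁻¹ (m%n<n (toℕ i + (k * q ∸ toℕ v)) n)) λ rot-i≡kq → i≢v (toℕ-injective (begin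
      toℕ i       ≡⟨ m<n⇒m%n≡m (toℕ<n i) ⟨
      toℕ i % n   ≡⟨ [m+o]%n≡[m′+o]%n⇒m%n≡m′%n (toℕ i) (toℕ v) s≤n (trans rot-i≡kq (sym (rotation-self v))) ⟩
      toℕ v % n   ≡⟨ m<n⇒m%n≡m (toℕ<n v) ⟩
      toℕ v       ∎))
    where
    open ≡-Reasoning
    s≤n : k * q ∸ toℕ v ≤ n
    s≤n = ≤-trans (m∸n≤m (k * q) (toℕ v)) (n≤1+n (k * q))

  deleted-colourable : ∀ v → Colourable (deleteVertex (G q k) v) k
  deleted-colourable v = residue-colouring rotated proper
    where
    rotated : V (deleteVertex (G q k) v) → ℕ
    rotated (i , _) = rotation v (toℕ i)

    proper : ∀ u w → Adj (deleteVertex (G q k) v) u w → rotated u % k ≢ rotated w % k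
    proper (i , i≢v) (j , j≢v) =
      [ residues-differ (rotation<kq i≢v) ∘ rotation-step v {toℕ i} {toℕ j}
      , (λ j→i → residues-differ (rotation<kq j≢v) (rotation-step v {toℕ j} {toℕ i} j→i) ∘ sym) ]

  colourable : Colourable (G q k) (suc k)
  colourable = extend-colouring fzero _≟ᶠ_ no-loop (deleted-colourable fzero)
    where
    no-loop : ¬ Adj (G q k) fzero fzero
    no-loop = [ (λ loop → residues-differ 0<kq loop refl) , (λ loop → residues-differ 0<kq loop refl) ]

  vertex : ℕ → Fin n
  vertex a = fromℕ< (m%n<n a n)

  short-offset : ∀ {d} → 0 < d → d < k → Offset q k d
  short-offset {1} _ _ = inj₁ refl
  short-offset {suc (suc d)} _ d<k =
    inj₂ (0 , suc (suc d) , 1≤q , s≤s (s≤s z≤n) , ∸-monoˡ-≤ 1 d<k , cong (_+ suc (suc d)) (sym (*-zeroʳ k)))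

  adjacent-near : ∀ a {d} → 0 < d → d < k → Adj (G q k) (vertex a) (vertex (a + d))
  adjacent-near a {d} 0<d d<k = inj₁ (d , short-offset 0<d d<k , (begin
      toℕ (vertex (a + d))          ≡⟨ toℕ-fromℕ< (m%n<n (a + d) n) ⟩
      (a + d) % n                   ≡⟨ [m%n+o]%n≡[m+o]%n a d n ⟨
      (a % n + d) % n               ≡⟨ cong (λ z → (z + d) % n) (toℕ-fromℕ< (m%n<n a n)) ⟨
      (toℕ (vertex a) + d) % n      ∎))
    where open ≡-Reasoning

  module _ (c : Fin n → Fin k) (proper : ∀ u w → Adj (G q k) u w → c u ≢ c w) where

    -- Pigeonhole on v_x, …, v_{x+k}: a repeated pair at distance < k would be an edge.
    colour-period : ∀ x → c (vertex (x + k)) ≡ c (vertex x)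
    colour-period x with pigeonhole (n<1+n k) (λ t → c (vertex (x + toℕ t)))
    ... | i , j , i<j , same with m<n≤o⇒n∸m<o⊎endpoints i<j (s≤s⁻¹ (toℕ<n j))
    ...   | inj₁ gap<k =
      ⊥-elim (proper _ _ (adjacent-near (x + toℕ i) (m<n⇒0<n∸m i<j) gap<k)
                         (trans same (cong (c ∘ vertex) (sym reach))))
      where
      reach : x + toℕ i + (toℕ j ∸ toℕ i) ≡ x + toℕ j
      reach = trans (+-assoc x (toℕ i) _) (cong (x +_) (m+[n∸m]≡n (<⇒≤ i<j)))
    ...   | inj₂ (i≡0 , j≡k) = begin
      c (vertex (x + k))        ≡⟨ cong (λ z → c (vertex (x + z))) j≡k ⟨
      c (vertex (x + toℕ j))    ≡⟨ same ⟨
      c (vertex (x + toℕ i))    ≡⟨ cong (λ z → c (vertex (x + z))) i≡0 ⟩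
      c (vertex (x + 0))        ≡⟨ cong (c ∘ vertex) (+-identityʳ x) ⟩
      c (vertex x)              ∎
      where open ≡-Reasoning

    colour-period-multiple : ∀ t → c (vertex (k * t)) ≡ c (vertex 0)
    colour-period-multiple zero = cong (c ∘ vertex) (*-zeroʳ k)
    colour-period-multiple (suc t) = begin
      c (vertex (k * suc t))    ≡⟨ cong (c ∘ vertex) (trans (*-suc k t) (+-comm k (k * t))) ⟩
      c (vertex (k * t + k))    ≡⟨ colour-period (k * t) ⟩
      c (vertex (k * t))        ≡⟨ colour-period-multiple t ⟩
      c (vertex 0)              ∎
      where open ≡-Reasoning

  not-k-colourable : ¬ Colourable (G q k) k
  not-k-colourable (c , proper) =
    proper (vertex (k * q)) (vertex (k * q + 1)) (adjacent-near (k * q) z<s 1<k)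
      (trans (colour-period-multiple c proper q) (cong c (sym wrap)))
    where
    wrap : vertex (k * q + 1) ≡ vertex 0
    wrap = toℕ-injective (trans (toℕ-fromℕ< _) (trans (cong (_% n) (+-comm (k * q) 1)) (n%n≡0 n)))

lemma2p6 : (q k : ℕ) → 3 ≤ k → 1 ≤ q → VertexCritical (G q k) (suc k)
lemma2p6 q k 3≤k 1≤q =
    (colourable , λ s s<1+k → not-k-colourable ∘ Colourable-mono (s≤s⁻¹ s<1+k))
  , λ v → k , n<1+n k , deleted-colourable v
  where
  open Circulant q k (≤-trans (s≤s (s≤s z≤n)) 3≤k) 1≤q
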